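{- Let $a,b_1,\ldots,b_n$ be non-negative integers. Then $a\mathbin{\downarrow} b_{\sigma(1)}\mathbin{\downarrow}\cdots\mathbin{\downarrow} b_{\sigma(n)}>0$ for some permutation $\sigma$ of $\{1,\ldots,n\}$ if and only if $a\mathbin{\downarrow} b_{\tau(1)}\mathbin{\downarrow}\cdots\mathbin{\downarrow} b_{\tau(n)}>0$ for every permutation $\tau$ of $\{1,\ldots,n\}$, where the operations are evaluated from left to right.
   Context: For non-negative integers $m,n$, $m\oplus n$ is bitwise XOR, and the lower nim-sum is $m\mathbin{\downarrow} n=\min_{0\le n'\le n} m\oplus n'$. -}

module Defs where

open import Data.Nat using (ℕ; zero; suc; _+_; _*_; _⊓_)
open import Data.Nat.DivMod using (_/_; _%_)
open import Data.Fin using (Fin)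
open import Data.Fin.Permutation using (Permutation′; _⟨$⟩ʳ_)

-- Bitwise XOR on ℕ, computed digit by digit in base 2.
-- The fuel argument bounds the number of binary digits processed;
-- fuel m + n (≥ number of bits of max m n) suffices, so xor is exact.
xorF : ℕ → ℕ → ℕ → ℕ
xorF zero    m n = 0
xorF (suc k) m n = ((m % 2 + n % 2) % 2) + 2 * xorF k (m / 2) (n / 2)

_⊕_ : ℕ → ℕ → ℕ
m ⊕ n = xorF (m + n) m n

minUpTo : (ℕ → ℕ) → ℕ → ℕ
minUpTo f zero    = f zero
minUpTo f (suc n) = minUpTo f n ⊓ f (suc n)

_↓_ : ℕ → ℕ → ℕ
m ↓ n = minUpTo (λ n′ → m ⊕ n′) n

infixl 6 _↓_

lowerNimFold : ℕ → (n : ℕ) → (Fin n → ℕ) → ℕ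
lowerNimFold a zero    b = a
lowerNimFold a (suc n) b = lowerNimFold (a ↓ b Fin.zero) n (λ i → b (Fin.suc i))

permute : {n : ℕ} → Permutation′ n → (Fin n → ℕ) → (Fin n → ℕ)
permute σ b i = b (σ ⟨$⟩ʳ i)

module Submission where

-- The lower nim-sum commutes in its right-hand arguments:
--   a ↓ b ↓ c ≡ a ↓ c ↓ b   (exchange law).
-- Hence a left-to-right fold of ↓ over b₁, …, bₙ does not depend on the
-- order of the bᵢ at all, so its positivity for one order is the same as for
-- every order, which is the theorem.
--
-- The exchange law is proved by induction on the binary digits of a, b, c.
-- Writing a number as bin r h = r + 2h (low bit r, high part h), xor acts
-- digitwise, and the lower nim-sum obeys the low-bit recursion
--   bin r a ↓ bin s b ≡ bin (r ∧ ¬s ∧ exact a b) (a ↓ b),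
-- where exact a b says that b itself attains the minimum defining a ↓ b.
-- The flag exact satisfies a similar recursion, from which follows an exchange
-- law for the pair of flags met along a ↓ b ↓ c; together with the induction
-- hypothesis this gives the exchange law.

open import Defs
open import Data.Nat using (ℕ; _<_)
open import Data.Fin using (Fin)
open import Data.Fin.Permutation using (Permutation′)
open import Data.Product using (∃; _×_)

open import Data.Nat using (zero; suc; _+_; _*_; _≤_; z≤n; s≤s; _≡ᵇ_)
open import Data.Nat.Properties
open import Data.Nat.DivMod using (_/_; _%_; m/n≡1+[m∸n]/n; m/n*n≤m)
open import Data.Bool using (Bool; true; false; _∧_; _∨_; not; _xor_; T)
open import Data.Bool.Properties using (∧-zeroʳ)
open import Data.Product using (Σ; _,_)
open import Data.Sum using (inj₁; inj₂)
open import Data.Unit using (tt)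
open import Data.Empty using (⊥-elim)
open import Relation.Nullary using (¬_; yes; no)
open import Relation.Binary.PropositionalEquality
open import Data.Fin using (punchIn) renaming (zero to fzero; suc to fsuc)
open import Data.Fin.Permutation using (_⟨$⟩ʳ_; remove; punchIn-permute; id)

bit : Bool → ℕ
bit false = 0
bit true  = 1

-- Doubling by structural recursion, so that parity and halving compute.
double : ℕ → ℕ
double zero    = zero
double (suc n) = suc (suc (double n))

bin : Bool → ℕ → ℕ
bin r h = bit r + double h

double≡+ : ∀ x → double x ≡ x + x
double≡+ zero    = refl
double≡+ (suc x) = cong suc (trans (cong suc (double≡+ x)) (sym (+-suc x x)))

2*≡double : ∀ x → 2 * x ≡ double x
2*≡double x = trans (cong (x +_) (+-identityʳ x)) (sym (double≡+ x))

double≤bin : ∀ r x → double x ≤ bin r x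
double≤bin false x = ≤-refl
double≤bin true  x = n≤1+n _

bin-view : ∀ n → Σ Bool λ r → Σ ℕ λ h → n ≡ bin r h
bin-view zero          = false , 0 , refl
bin-view (suc zero)    = true , 0 , refl
bin-view (suc (suc n)) with bin-view n
... | false , h , eq = false , suc h , cong (λ x → suc (suc x)) eq
... | true  , h , eq = true  , suc h , cong (λ x → suc (suc x)) eq

2+n/2 : ∀ n → suc (suc n) / 2 ≡ suc (n / 2)
2+n/2 n = m/n≡1+[m∸n]/n {suc (suc n)} {2} (s≤s (s≤s z≤n))

bin%2 : ∀ r h → bin r h % 2 ≡ bit r
bin%2 false zero    = refl
bin%2 true  zero    = refl
bin%2 false (suc h) = bin%2 false h
bin%2 true  (suc h) = bin%2 true h

bin/2 : ∀ r h → bin r h / 2 ≡ h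
bin/2 false zero    = refl
bin/2 true  zero    = refl
bin/2 false (suc h) = trans (2+n/2 (double h)) (cong suc (bin/2 false h))
bin/2 true  (suc h) = trans (2+n/2 (suc (double h))) (cong suc (bin/2 true h))

bit-injective : ∀ u v → bit u ≡ bit v → u ≡ v
bit-injective false false _ = refl
bit-injective true  true  _ = refl
bit-injective false true  ()
bit-injective true  false ()

bin-injective : ∀ u v x y → bin u x ≡ bin v y → (u ≡ v) × (x ≡ y)
bin-injective u v x y e =
  bit-injective u v (trans (sym (bin%2 u x)) (trans (cong (_% 2) e) (bin%2 v y))) ,
  trans (sym (bin/2 u x)) (trans (cong (_/ 2) e) (bin/2 v y))

bin-<-high : ∀ u v x y → x < y → bin u x < bin v y
bin-<-high u v x y x<y = ≤-trans (s≤s (bin≤odd u)) (≤-trans (double-mono x<y) (double≤bin v y))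
  where
  bin≤odd : ∀ u → bin u x ≤ suc (double x)
  bin≤odd false = n≤1+n _
  bin≤odd true  = ≤-refl
  double-mono : ∀ {x y} → x ≤ y → double x ≤ double y
  double-mono z≤n       = z≤n
  double-mono (s≤s x≤y) = s≤s (s≤s (double-mono x≤y))

bin-≤⇒high-≤ : ∀ u v x y → bin u x ≤ bin v y → x ≤ y
bin-≤⇒high-≤ u v x y p with x ≤? y
... | yes x≤y = x≤y
... | no  x≰y = ⊥-elim (<⇒≱ (bin-<-high v u y x (≰⇒> x≰y)) p)

bin-≤-even⇒even : ∀ u x → bin u x ≤ bin false x → u ≡ false
bin-≤-even⇒even false x p = refl
bin-≤-even⇒even true  x p = ⊥-elim (1+n≰n p)

bin-mono : ∀ w u x y → x ≤ y → (x ≡ y → w ≡ true → u ≡ true) → bin w x ≤ bin u y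
bin-mono w u x y x≤y tie with m≤n⇒m<n∨m≡n x≤y
... | inj₁ x<y  = <⇒≤ (bin-<-high w u x y x<y)
... | inj₂ refl with w | u | tie refl
... | false | false | _ = ≤-refl
... | false | true  | _ = n≤1+n _
... | true  | true  | _ = ≤-refl
... | true  | false | impossible with impossible refl
... | ()

-- Halving shrinks sizes; this bounds both the fuel of xor and digit induction.

half+half≤ : ∀ m → m / 2 + m / 2 ≤ m
half+half≤ m = ≤-trans (≤-reflexive (trans (cong (m / 2 +_) (sym (+-identityʳ (m / 2)))) (*-comm 2 (m / 2))))
                       (m/n*n≤m m 2)

interchange : ∀ x y → (x + x) + (y + y) ≡ (x + y) + (x + y)
interchange x y = trans (+-assoc x x (y + y)) (trans (cong (x +_) (trans (sym (+-assoc x y y))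
  (trans (cong (_+ y) (+-comm x y)) (+-assoc y x y)))) (sym (+-assoc x y (x + y))))

z+z≤1+k⇒z≤k : ∀ z k → z + z ≤ suc k → z ≤ k
z+z≤1+k⇒z≤k zero    k p       = z≤n
z+z≤1+k⇒z≤k (suc z) k (s≤s p) = ≤-trans (m≤n+m (suc z) z) p

halves-≤ : ∀ m n k → m + n ≤ suc k → m / 2 + n / 2 ≤ k
halves-≤ m n k p = z+z≤1+k⇒z≤k (m / 2 + n / 2) k
  (≤-trans (≤-reflexive (sym (interchange (m / 2) (n / 2)))) (≤-trans (+-mono-≤ (half+half≤ m) (half+half≤ n)) p))

xorF-zero : ∀ k → xorF k 0 0 ≡ 0
xorF-zero zero    = refl
xorF-zero (suc k) rewrite xorF-zero k = refl

xorF-fuel : ∀ k k′ m n → m + n ≤ k → m + n ≤ k′ → xorF k m n ≡ xorF k′ m n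
xorF-fuel zero    zero     m    n    p q = refl
xorF-fuel zero    (suc k′) zero zero p q = sym (xorF-zero (suc k′))
xorF-fuel (suc k) zero     zero zero p q = xorF-zero (suc k)
xorF-fuel (suc k) (suc k′) m    n    p q = cong (λ x → ((m % 2 + n % 2) % 2) + 2 * x)
  (xorF-fuel k k′ (m / 2) (n / 2) (halves-≤ m n k p) (halves-≤ m n k′ q))

bit-xor : ∀ r s → (bit r + bit s) % 2 ≡ bit (r xor s)
bit-xor false false = refl
bit-xor false true  = refl
bit-xor true  false = refl
bit-xor true  true  = refl

xorF-bin : ∀ k r s a b → xorF (suc k) (bin r a) (bin s b) ≡ bin (r xor s) (xorF k a b)
xorF-bin k r s a b rewrite bin%2 r a | bin%2 s b | bin/2 r a | bin/2 s b
                         | bit-xor r s | 2*≡double (xorF k a b) = refl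

⊕-bin : ∀ r s a b → bin r a ⊕ bin s b ≡ bin (r xor s) (a ⊕ b)
⊕-bin r s a b = begin
  xorF (A + B) A B            ≡⟨ xorF-fuel (A + B) (suc (A + B)) A B ≤-refl (n≤1+n _) ⟩
  xorF (suc (A + B)) A B      ≡⟨ xorF-bin (A + B) r s a b ⟩
  bin (r xor s) (xorF (A + B) a b) ≡⟨ cong (bin (r xor s)) (xorF-fuel (A + B) (a + b) a b high≤ ≤-refl) ⟩
  bin (r xor s) (a ⊕ b)       ∎
  where
  open ≡-Reasoning
  A = bin r a
  B = bin s b
  high≤ : a + b ≤ A + B
  high≤ = +-mono-≤ (high≤bin r a) (high≤bin s b)
    where
    high≤bin : ∀ r x → x ≤ bin r x
    high≤bin r x = ≤-trans (m≤m+n x x) (≤-trans (≤-reflexive (sym (double≡+ x))) (double≤bin r x))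

bin-induction₃ : (P : ℕ → ℕ → ℕ → Set) → P 0 0 0 →
  (∀ r s t a b c → P a b c → P (bin r a) (bin s b) (bin t c)) → ∀ a b c → P a b c
bin-induction₃ P base step a b c = go (a + b + c) a b c ≤-refl
  where
  go : ∀ k a b c → a + b + c ≤ k → P a b c
  go zero    zero zero zero p = base
  go (suc k) a b c p with bin-view a | bin-view b | bin-view c
  ... | r , a′ , refl | s , b′ , refl | t , c′ , refl =
    step r s t a′ b′ c′ (go k a′ b′ c′ (z+z≤1+k⇒z≤k (a′ + b′ + c′) k (≤-trans (≤-reflexive sum-twice)
      (≤-trans (+-mono-≤ (+-mono-≤ (double≤bin r a′) (double≤bin s b′)) (double≤bin t c′)) p))))
    where
    sum-twice : (a′ + b′ + c′) + (a′ + b′ + c′) ≡ double a′ + double b′ + double c′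
    sum-twice rewrite double≡+ a′ | double≡+ b′ | double≡+ c′ =
      trans (sym (interchange (a′ + b′) c′)) (cong (_+ (c′ + c′)) (sym (interchange a′ b′)))

xor-cancelˡ : ∀ r s t → (r xor s) ≡ (r xor t) → s ≡ t
xor-cancelˡ false s     t     e = e
xor-cancelˡ true  false false e = refl
xor-cancelˡ true  true  true  e = refl
xor-cancelˡ true  false true  ()
xor-cancelˡ true  true  false ()

⊕-cancelˡ : ∀ a m b → a ⊕ m ≡ a ⊕ b → m ≡ b
⊕-cancelˡ = bin-induction₃ (λ a m b → a ⊕ m ≡ a ⊕ b → m ≡ b) (λ _ → refl) step
  where
  step : ∀ r s t a b c → (a ⊕ b ≡ a ⊕ c → b ≡ c) →
         bin r a ⊕ bin s b ≡ bin r a ⊕ bin t c → bin s b ≡ bin t c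
  step r s t a b c ih e rewrite ⊕-bin r s a b | ⊕-bin r t a c with bin-injective _ _ _ _ e
  ... | e-low , e-high = cong₂ bin (xor-cancelˡ r s t e-low) (ih e-high)

minUpTo-≤ : ∀ f b n → n ≤ b → minUpTo f b ≤ f n
minUpTo-≤ f zero    zero p = ≤-refl
minUpTo-≤ f (suc b) n    p with m≤n⇒m<n∨m≡n p
... | inj₁ n<1+b = ≤-trans (m⊓n≤m _ _) (minUpTo-≤ f b n (≤-pred n<1+b))
... | inj₂ refl  = m⊓n≤n _ _

minUpTo-attained : ∀ f b → ∃ λ m → (m ≤ b) × (minUpTo f b ≡ f m)
minUpTo-attained f zero    = 0 , z≤n , refl
minUpTo-attained f (suc b) with ⊓-sel (minUpTo f b) (f (suc b))
... | inj₁ e = let (m , m≤b , e′) = minUpTo-attained f b in m , ≤-trans m≤b (n≤1+n b) , trans e e′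
... | inj₂ e = suc b , ≤-refl , e

minUpTo-unique : ∀ f b v → (∃ λ n → (n ≤ b) × (f n ≡ v)) → (∀ n → n ≤ b → v ≤ f n) → minUpTo f b ≡ v
minUpTo-unique f b v (n , n≤b , e) lower with minUpTo-attained f b
... | m , m≤b , e′ = ≤-antisym (≤-trans (minUpTo-≤ f b n n≤b) (≤-reflexive e))
                               (≤-trans (lower m m≤b) (≤-reflexive (sym e′)))

exact : ℕ → ℕ → Bool
exact a b = (a ↓ b) ≡ᵇ (a ⊕ b)

exact-true : ∀ a b → exact a b ≡ true → a ↓ b ≡ a ⊕ b
exact-true a b e = ≡ᵇ⇒≡ (a ↓ b) (a ⊕ b) (subst T (sym e) tt)

exact-false : ∀ a b → exact a b ≡ false → ¬ (a ↓ b ≡ a ⊕ b)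
exact-false a b e q = subst T e (≡⇒≡ᵇ (a ↓ b) (a ⊕ b) q)

-- Lower-bound step of the recursion below: if n = bin t k ≤ bin s b ties with
-- the minimum a ↓ b in the high part, and the claimed low bit of the minimum is
-- 1, then the low bit of bin r a ⊕ n is 1 as well (else k = b and t = s = 0).
low-bit-forced : ∀ r s t a b k → bin t k ≤ bin s b → a ↓ b ≡ a ⊕ k →
                 r ∧ (not s ∧ exact a b) ≡ true → (r xor t) ≡ true
low-bit-forced r s t a b k p e flag with r | s | exact a b in eq
low-bit-forced r s t a b k p e () | false | _     | _
low-bit-forced r s t a b k p e () | true  | true  | _
low-bit-forced r s t a b k p e () | true  | false | false
... | true | false | true with ⊕-cancelˡ a k b (trans (sym e) (exact-true a b eq))
... | refl with bin-≤-even⇒even t k p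
... | refl = refl

↓-bin : ∀ r s a b → bin r a ↓ bin s b ≡ bin (r ∧ (not s ∧ exact a b)) (a ↓ b)
↓-bin r s a b = minUpTo-unique (λ n → bin r a ⊕ n) (bin s b) _ attained below
  where
  w = r ∧ (not s ∧ exact a b)
  -- When b is exact, choose high part b and cancel r if s allows it; otherwise
  -- some m < b attains a ↓ b and the low bit can be matched freely.
  attained : ∃ λ n → (n ≤ bin s b) × (bin r a ⊕ n ≡ bin w (a ↓ b))
  attained with exact a b in eq
  ... | true = bin (r ∧ s) b , bin-mono _ _ _ _ ≤-refl (λ _ → ∧-true⇒right r s) ,
               trans (⊕-bin r (r ∧ s) a b) (cong₂ bin (low r s) (sym (exact-true a b eq)))
    where
    ∧-true⇒right : ∀ r s → r ∧ s ≡ true → s ≡ true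
    ∧-true⇒right true true _ = refl
    ∧-true⇒right false _ ()
    ∧-true⇒right true false ()
    low : ∀ r s → (r xor (r ∧ s)) ≡ (r ∧ (not s ∧ true))
    low false s     = refl
    low true  false = refl
    low true  true  = refl
  ... | false with minUpTo-attained (λ n → a ⊕ n) b
  ... | m , m≤b , e = bin r m , <⇒≤ (bin-<-high r s m b m<b) ,
                      trans (⊕-bin r r a m) (cong₂ bin (low r s) (sym e))
    where
    m<b : m < b
    m<b with m≤n⇒m<n∨m≡n m≤b
    ... | inj₁ m<b = m<b
    ... | inj₂ refl = ⊥-elim (exact-false a b eq e)
    low : ∀ r s → (r xor r) ≡ (r ∧ (not s ∧ false))
    low false s     = refl
    low true  false = refl
    low true  true  = refl
  below : ∀ n → n ≤ bin s b → bin w (a ↓ b) ≤ bin r a ⊕ n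
  below n n≤ with bin-view n
  ... | t , k , refl rewrite ⊕-bin r t a k =
    bin-mono w (r xor t) (a ↓ b) (a ⊕ k)
      (minUpTo-≤ (λ n → a ⊕ n) b k (bin-≤⇒high-≤ t s k b n≤)) (low-bit-forced r s t a b k n≤)

double-≡ᵇ-double : ∀ x y → (double x ≡ᵇ double y) ≡ (x ≡ᵇ y)
double-≡ᵇ-double zero    zero    = refl
double-≡ᵇ-double zero    (suc y) = refl
double-≡ᵇ-double (suc x) zero    = refl
double-≡ᵇ-double (suc x) (suc y) = double-≡ᵇ-double x y

double-≡ᵇ-odd : ∀ x y → (double x ≡ᵇ suc (double y)) ≡ false
double-≡ᵇ-odd zero    y       = refl
double-≡ᵇ-odd (suc x) zero    = refl
double-≡ᵇ-odd (suc x) (suc y) = double-≡ᵇ-odd x y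

odd-≡ᵇ-double : ∀ x y → (suc (double x) ≡ᵇ double y) ≡ false
odd-≡ᵇ-double x       zero    = refl
odd-≡ᵇ-double zero    (suc y) = refl
odd-≡ᵇ-double (suc x) (suc y) = odd-≡ᵇ-double x y

bin-≡ᵇ : ∀ u v x y → (bin u x ≡ᵇ bin v y) ≡ (not (u xor v) ∧ (x ≡ᵇ y))
bin-≡ᵇ false false x y = double-≡ᵇ-double x y
bin-≡ᵇ true  true  x y = double-≡ᵇ-double x y
bin-≡ᵇ false true  x y = double-≡ᵇ-odd x y
bin-≡ᵇ true  false x y = odd-≡ᵇ-double x y

exact-bin : ∀ r s a b → exact (bin r a) (bin s b) ≡ ((r ∨ not s) ∧ exact a b)
exact-bin r s a b rewrite ↓-bin r s a b | ⊕-bin r s a b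
                        | bin-≡ᵇ (r ∧ (not s ∧ exact a b)) (r xor s) (a ↓ b) (a ⊕ b) = low r s (exact a b)
  where
  low : ∀ r s e → (not ((r ∧ (not s ∧ e)) xor (r xor s)) ∧ e) ≡ ((r ∨ not s) ∧ e)
  low false false false = refl
  low false false true  = refl
  low false true  false = refl
  low false true  true  = refl
  low true  false false = refl
  low true  false true  = refl
  low true  true  false = refl
  low true  true  true  = refl

∧-interchange : ∀ x y p q → ((x ∧ p) ∧ (y ∧ q)) ≡ ((x ∧ y) ∧ (p ∧ q))
∧-interchange false y    p q = refl
∧-interchange true  false p q = ∧-zeroʳ p
∧-interchange true  true  p q = refl

exact-exchange : ∀ a b c → (exact a b ∧ exact (a ⊕ b) c) ≡ (exact a c ∧ exact (a ⊕ c) b)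
exact-exchange = bin-induction₃ (λ a b c → (exact a b ∧ exact (a ⊕ b) c) ≡ (exact a c ∧ exact (a ⊕ c) b)) refl step
  where
  low-symmetric : ∀ r s t → ((r ∨ not s) ∧ ((r xor s) ∨ not t)) ≡ ((r ∨ not t) ∧ ((r xor t) ∨ not s))
  low-symmetric false false false = refl
  low-symmetric false false true  = refl
  low-symmetric false true  false = refl
  low-symmetric false true  true  = refl
  low-symmetric true  false false = refl
  low-symmetric true  false true  = refl
  low-symmetric true  true  false = refl
  low-symmetric true  true  true  = refl
  split : ∀ r s t a b c → (exact (bin r a) (bin s b) ∧ exact (bin r a ⊕ bin s b) (bin t c)) ≡
          (((r ∨ not s) ∧ ((r xor s) ∨ not t)) ∧ (exact a b ∧ exact (a ⊕ b) c))
  split r s t a b c = trans (cong (λ x → exact (bin r a) (bin s b) ∧ exact x (bin t c)) (⊕-bin r s a b))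
    (trans (cong₂ _∧_ (exact-bin r s a b) (exact-bin (r xor s) t (a ⊕ b) c))
           (∧-interchange (r ∨ not s) ((r xor s) ∨ not t) (exact a b) (exact (a ⊕ b) c)))
  step : ∀ r s t a b c → (exact a b ∧ exact (a ⊕ b) c) ≡ (exact a c ∧ exact (a ⊕ c) b) →
    (exact (bin r a) (bin s b) ∧ exact (bin r a ⊕ bin s b) (bin t c)) ≡
    (exact (bin r a) (bin t c) ∧ exact (bin r a ⊕ bin t c) (bin s b))
  step r s t a b c ih =
    trans (split r s t a b c) (trans (cong₂ _∧_ (low-symmetric r s t) ih) (sym (split r t s a c b)))

-- When b is exact, a ↓ b and a ⊕ b coincide, so the second flag may use either.
exact-after-↓ : ∀ a b c → (exact a b ∧ exact (a ↓ b) c) ≡ (exact a b ∧ exact (a ⊕ b) c)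
exact-after-↓ a b c with exact a b in eq
... | false = refl
... | true rewrite exact-true a b eq = refl

exact-exchange-↓ : ∀ a b c → (exact a b ∧ exact (a ↓ b) c) ≡ (exact a c ∧ exact (a ↓ c) b)
exact-exchange-↓ a b c = trans (exact-after-↓ a b c) (trans (exact-exchange a b c) (sym (exact-after-↓ a c b)))

-- The exchange law a ↓ b ↓ c ≡ a ↓ c ↓ b: the low bits agree by the flag
-- exchange law, the high parts by induction.
↓-exchange : ∀ a b c → a ↓ b ↓ c ≡ a ↓ c ↓ b
↓-exchange = bin-induction₃ (λ a b c → a ↓ b ↓ c ≡ a ↓ c ↓ b) refl step
  where
  low : ∀ r s t p q p′ q′ → (p ∧ q) ≡ (p′ ∧ q′) →
        ((r ∧ (not s ∧ p)) ∧ (not t ∧ q)) ≡ ((r ∧ (not t ∧ p′)) ∧ (not s ∧ q′))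
  low false s     t     p q p′ q′ h = refl
  low true  false false p q p′ q′ h = h
  low true  true  false p q p′ q′ h = sym (∧-zeroʳ p′)
  low true  false true  p q p′ q′ h = ∧-zeroʳ p
  low true  true  true  p q p′ q′ h = refl
  step : ∀ r s t a b c → a ↓ b ↓ c ≡ a ↓ c ↓ b → bin r a ↓ bin s b ↓ bin t c ≡ bin r a ↓ bin t c ↓ bin s b
  step r s t a b c ih rewrite ↓-bin r s a b | ↓-bin r t a c
    | ↓-bin (r ∧ (not s ∧ exact a b)) t (a ↓ b) c | ↓-bin (r ∧ (not t ∧ exact a c)) s (a ↓ c) b
    = cong₂ bin (low r s t (exact a b) (exact (a ↓ b) c) (exact a c) (exact (a ↓ c) b) (exact-exchange-↓ a b c)) ih

lowerNimFold-cong : ∀ n a (b c : Fin n → ℕ) → (∀ i → b i ≡ c i) → lowerNimFold a n b ≡ lowerNimFold a n c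
lowerNimFold-cong zero    a b c h = refl
lowerNimFold-cong (suc n) a b c h = trans (cong (λ x → lowerNimFold (a ↓ x) n (λ i → b (fsuc i))) (h fzero))
  (lowerNimFold-cong n (a ↓ c fzero) _ _ (λ i → h (fsuc i)))

lowerNimFold-extract : ∀ n a (b : Fin (suc n) → ℕ) j →
  lowerNimFold a (suc n) b ≡ lowerNimFold (a ↓ b j) n (λ i → b (punchIn j i))
lowerNimFold-extract n       a b fzero    = refl
lowerNimFold-extract (suc n) a b (fsuc j) = trans (lowerNimFold-extract n (a ↓ b fzero) (λ i → b (fsuc i)) j)
  (cong (λ x → lowerNimFold x n (λ i → b (fsuc (punchIn j i)))) (↓-exchange a (b fzero) (b (fsuc j))))

lowerNimFold-permute : ∀ n a (b : Fin n → ℕ) (π : Permutation′ n) →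
  lowerNimFold a n (permute π b) ≡ lowerNimFold a n b
lowerNimFold-permute zero    a b π = refl
lowerNimFold-permute (suc n) a b π = begin
  lowerNimFold (a ↓ b j) n (λ i → b (π ⟨$⟩ʳ fsuc i))
    ≡⟨ lowerNimFold-cong n _ _ _ (λ i → cong b (punchIn-permute π fzero i)) ⟩
  lowerNimFold (a ↓ b j) n (permute (remove fzero π) b′)
    ≡⟨ lowerNimFold-permute n (a ↓ b j) b′ (remove fzero π) ⟩
  lowerNimFold (a ↓ b j) n b′
    ≡⟨ sym (lowerNimFold-extract n a b j) ⟩
  lowerNimFold a (suc n) b ∎
  where
  open ≡-Reasoning
  j = π ⟨$⟩ʳ fzero
  b′ = λ i → b (punchIn j i)

lemma4p17 : (a n : ℕ) (b : Fin n → ℕ) →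
    ((∃ λ (σ : Permutation′ n) → 0 < lowerNimFold a n (permute σ b)) →
    ((τ : Permutation′ n) → 0 < lowerNimFold a n (permute τ b)))
    × (((τ : Permutation′ n) → 0 < lowerNimFold a n (permute τ b)) →
    (∃ λ (σ : Permutation′ n) → 0 < lowerNimFold a n (permute σ b)))
lemma4p17 a n b = some⇒all , (λ all → id , all id)
  where
  some⇒all : (∃ λ σ → 0 < lowerNimFold a n (permute σ b)) → (τ : Permutation′ n) → 0 < lowerNimFold a n (permute τ b)
  some⇒all (σ , pos) τ =
    subst (0 <_) (trans (lowerNimFold-permute n a b σ) (sym (lowerNimFold-permute n a b τ))) pos
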